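{- For every odd integer $j\ge1$ and all odd integers $a_{j+2}\ge a_{j+1}\ge3$, the tree $RT(0^j,a_{j+1},a_{j+2})$ is super edge-graceful.
   Context: For a finite simple graph $G$ with $p$ vertices and $q$ edges, $G$ is super edge-graceful if there is a bijection $f$ from $E(G)$ onto $\{0,\pm1,\ldots,\pm\frac{q-1}{2}\}$ when $q$ is odd, and onto $\{\pm1,\ldots,\pm\frac{q}{2}\}$ when $q$ is even, such that the induced vertex labeling $f^+(v)=\sum_{uv\in E(G)} f(uv)$ is a bijection from $V(G)$ onto $\{0,\pm1,\ldots,\pm\frac{p-1}{2}\}$ when $p$ is odd, and onto $\{\pm1,\ldots,\pm\frac{p}{2}\}$ when $p$ is even. $RT(0^j,a,b)$ denotes the rooted tree with root $v_0$ having $j+2$ children: $j$ of them are leaves, one has exactly $a$ children (all leaves) and one has exactly $b$ children (all leaves). -}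

module Defs where

open import Data.Nat as ℕ using (ℕ; zero; suc; _%_; _<ᵇ_)
open import Data.Integer as ℤ using (ℤ; ∣_∣)
open import Data.Fin using (Fin; zero; suc; toℕ; _≟_)
open import Data.Product using (Σ; ∃; _×_; _,_; proj₁; proj₂)
open import Data.Bool using (Bool; true; false; if_then_else_; _∨_)
open import Relation.Nullary using (¬_; does)
open import Relation.Binary.PropositionalEquality using (_≡_)

Odd : ℕ → Set
Odd n = ∃ λ k → n ≡ suc (2 ℕ.* k)

-- z belongs to the standard label set of size n:
--   n odd : {0, ±1, …, ±(n-1)/2}, i.e. 2|z| + 1 ≤ n
--   n even: {±1, …, ±n/2},        i.e. z ≠ 0 and 2|z| ≤ n
InLabels : ℕ → ℤ → Set
InLabels n z with n % 2
... | 0 = (¬ (z ≡ ℤ.0ℤ)) × (2 ℕ.* ∣ z ∣ ℕ.≤ n)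
... | _ = suc (2 ℕ.* ∣ z ∣) ℕ.≤ n

BijOntoLabels : (n : ℕ) → (Fin n → ℤ) → Set
BijOntoLabels n g =
  ((x : Fin n) → InLabels n (g x)) ×
  ((x y : Fin n) → g x ≡ g y → x ≡ y) ×
  ((z : ℤ) → InLabels n z → ∃ λ x → g x ≡ z)

sumℤ : (n : ℕ) → (Fin n → ℤ) → ℤ
sumℤ zero    h = ℤ.0ℤ
sumℤ (suc n) h = h zero ℤ.+ sumℤ n (λ i → h (suc i))

record Graph : Set where
  field
    p    : ℕ
    q    : ℕ
    ends : Fin q → Fin p × Fin p

open Graph public

incident : (G : Graph) → Fin (p G) → Fin (q G) → Bool
incident G v e = does (v ≟ proj₁ (ends G e)) ∨ does (v ≟ proj₂ (ends G e))

vertexSum : (G : Graph) → (Fin (q G) → ℤ) → Fin (p G) → ℤ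
vertexSum G f v = sumℤ (q G) (λ e → if incident G v e then f e else ℤ.0ℤ)

SuperEdgeGraceful : Graph → Set
SuperEdgeGraceful G =
  Σ (Fin (q G) → ℤ) λ f →
    BijOntoLabels (q G) f × BijOntoLabels (p G) (vertexSum G f)

-- The natural number k as an element of Fin (suc n) (clamped at n;
-- only used with k ≤ n, where it is exact).
clamp : (n : ℕ) → ℕ → Fin (suc n)
clamp n       zero    = zero
clamp zero    (suc k) = zero
clamp (suc n) (suc k) = suc (clamp n k)

-- RT(0^j, a, b): vertices 0 .. j+a+b+2, root 0.
--   children of the root : 1 .. j+2  (1..j leaves, j+1 and j+2 internal)
--   children of j+1      : j+3 .. j+a+2           (a leaves)
--   children of j+2      : j+a+3 .. j+a+b+2       (b leaves)
-- Edge number i (i < q = j+a+b+2) joins vertex i+1 to its parent.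
RTq : ℕ → ℕ → ℕ → ℕ
RTq j a b = j ℕ.+ 2 ℕ.+ a ℕ.+ b

RTparent : ℕ → ℕ → ℕ → ℕ → ℕ
RTparent j a b i =
  if i <ᵇ j ℕ.+ 2 then 0
  else if i <ᵇ j ℕ.+ 2 ℕ.+ a then j ℕ.+ 1
  else j ℕ.+ 2

RT : ℕ → ℕ → ℕ → Graph
RT j a b = record
  { p    = suc (RTq j a b)
  ; q    = RTq j a b
  ; ends = λ i → clamp (RTq j a b) (RTparent j a b (toℕ i)) , suc i
  }

module Submission where

-- Write j = 2J + 1, a = 2A + 3, b = 2B + 3 and m = J + A + B + 4: the tree has 2m + 1
-- edges and 2m + 2 vertices. Edge k joins vertex k + 1 to its parent, so an edge
-- labelling is a sequence h : ℕ → ℤ, and the label of a vertex is the sum of the labels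
-- of the edges to its children plus the label of the edge entering it.

open import Defs
open import Data.Nat using (ℕ; _≤_)
open import Data.Nat as ℕ using (zero; suc; _+_; _*_; _∸_; _<_; _<ᵇ_; z≤n; s≤s; z<s; s<s; _<?_)
import Data.Nat.Properties as ℕP
import Data.Nat.DivMod as ℕD
open import Data.Nat.Tactic.RingSolver using (solve-∀)
open import Data.Integer as ℤ using (ℤ; +_; -[1+_]; ∣_∣; 0ℤ)
import Data.Integer.Properties as ℤP
import Data.Integer.Tactic.RingSolver as ℤSolver
open import Algebra.Properties.CommutativeSemigroup ℤP.+-commutativeSemigroup using (interchange)
open import Data.Fin as Fin using (Fin; zero; suc; toℕ; fromℕ<)
import Data.Fin.Properties as FinP
open import Data.Product using (∃; _×_; _,_; proj₁; proj₂)
open import Data.Sum using (_⊎_; inj₁; inj₂)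
open import Data.Bool using (Bool; true; false; if_then_else_; _∨_)
open import Function using (_∘_; _⇔_; mk⇔; Equivalence)
open import Function.Definitions using (Injective)
open import Relation.Nullary using (¬_; Dec; does; yes; no; contradiction)
open import Relation.Nullary.Decidable using (dec-true; dec-false)
open import Relation.Binary.PropositionalEquality

∑ : ℕ → (ℕ → ℤ) → ℤ
∑ zero    h = 0ℤ
∑ (suc n) h = h 0 ℤ.+ ∑ n (h ∘ suc)

sumℤ≡∑ : ∀ n (g : Fin n → ℤ) (h : ℕ → ℤ) → (∀ e → g e ≡ h (toℕ e)) → sumℤ n g ≡ ∑ n h
sumℤ≡∑ zero    g h g≗h = refl
sumℤ≡∑ (suc n) g h g≗h = cong₂ ℤ._+_ (g≗h zero) (sumℤ≡∑ n (g ∘ suc) (h ∘ suc) (g≗h ∘ suc))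

∑-cong : ∀ n {g h : ℕ → ℤ} → (∀ k → k < n → g k ≡ h k) → ∑ n g ≡ ∑ n h
∑-cong zero    g≗h = refl
∑-cong (suc n) g≗h = cong₂ ℤ._+_ (g≗h 0 z<s) (∑-cong n (λ k k<n → g≗h (suc k) (s<s k<n)))

∑-zero : ∀ n → ∑ n (λ _ → 0ℤ) ≡ 0ℤ
∑-zero zero    = refl
∑-zero (suc n) = trans (ℤP.+-identityˡ _) (∑-zero n)

∑-+ : ∀ m n h → ∑ (m + n) h ≡ ∑ m h ℤ.+ ∑ n (λ t → h (m + t))
∑-+ zero    n h = sym (ℤP.+-identityˡ _)
∑-+ (suc m) n h = trans (cong (ℤ._+_ (h 0)) (∑-+ m n (h ∘ suc))) (sym (ℤP.+-assoc (h 0) _ _))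

∑-distrib : ∀ n g h → ∑ n (λ k → g k ℤ.+ h k) ≡ ∑ n g ℤ.+ ∑ n h
∑-distrib zero    g h = refl
∑-distrib (suc n) g h =
  trans (cong (ℤ._+_ (g 0 ℤ.+ h 0)) (∑-distrib n (g ∘ suc) (h ∘ suc))) (interchange (g 0) (h 0) _ _)

when : Bool → ℤ → ℤ
when b x = if b then x else 0ℤ

infix 4 _≡?_
_≡?_ : ℕ → ℕ → Bool
m ≡? n = does (m ℕ.≟ n)

when-yes : ∀ {m n} x → m ≡ n → when (m ≡? n) x ≡ x
when-yes {m} {n} x m≡n = cong (λ b → when b x) (dec-true (m ℕ.≟ n) m≡n)

when-no : ∀ {m n} x → m ≢ n → when (m ≡? n) x ≡ 0ℤ
when-no {m} {n} x m≢n = cong (λ b → when b x) (dec-false (m ℕ.≟ n) m≢n)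

∑-when : ∀ n b h → ∑ n (λ k → when b (h k)) ≡ when b (∑ n h)
∑-when n true  h = refl
∑-when n false h = ∑-zero n

when-∨ : ∀ {P Q : Set} (p? : Dec P) (q? : Dec Q) x → ¬ (P × Q) →
  when (does p? ∨ does q?) x ≡ when (does p?) x ℤ.+ when (does q?) x
when-∨ (yes p) (yes q) x ¬pq = contradiction (p , q) ¬pq
when-∨ (yes _) (no _)  x _   = sym (ℤP.+-identityʳ x)
when-∨ (no _)  (yes _) x _   = sym (ℤP.+-identityˡ x)
when-∨ (no _)  (no _)  x _   = refl

-- incoming h v is the label h (v - 1) of the edge entering v, and 0 for v = 0.
incoming : (ℕ → ℤ) → ℕ → ℤ
incoming h zero    = 0ℤ
incoming h (suc k) = h k

-- Among the indices k < n, at most one satisfies v = k + 1, and it exists iff 1 ≤ v ≤ n.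
∑-incoming : ∀ n h v → v ≤ n → ∑ n (λ k → when (v ≡? suc k) (h k)) ≡ incoming h v
∑-incoming zero    h zero          _          = refl
∑-incoming (suc n) h zero          _          =
  trans (ℤP.+-identityˡ _) (∑-incoming n (h ∘ suc) zero z≤n)
∑-incoming (suc n) h (suc zero)    _          =
  trans (cong (ℤ._+_ (h 0)) (∑-incoming n (h ∘ suc) zero z≤n)) (ℤP.+-identityʳ (h 0))
∑-incoming (suc n) h (suc (suc v)) (s≤s v<n) =
  trans (ℤP.+-identityˡ _) (∑-incoming n (h ∘ suc) (suc v) v<n)

Hits : ℕ → (ℕ → ℤ) → ℤ → Set
Hits n g z = ∃ λ k → k < n × g k ≡ z

Hits± : ℕ → (ℕ → ℤ) → ℕ → Set
Hits± n g v = Hits n g (+ v) × Hits n g (ℤ.- (+ v))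

Hits±-map : ∀ {n n' f g v} → (∀ {z} → Hits n f z → Hits n' g z) → Hits± n f v → Hits± n' g v
Hits±-map lift (pos , neg) = lift pos , lift neg

Hits-suc : ∀ {n g z} → Hits n (g ∘ suc) z → Hits (suc n) g z
Hits-suc (k , k<n , gk≡z) = suc k , s<s k<n , gk≡z

_⊕⟨_⟩_ : (ℕ → ℤ) → ℕ → (ℕ → ℤ) → ℕ → ℤ
(f ⊕⟨ n ⟩ g) k = if k <ᵇ n then f k else g (k ∸ n)

module _ (f : ℕ → ℤ) (n : ℕ) (g : ℕ → ℤ) where

  ⊕-left : ∀ {k} → k < n → (f ⊕⟨ n ⟩ g) k ≡ f k
  ⊕-left {k} k<n = cong (λ b → if b then f k else g (k ∸ n)) (dec-true (k <? n) k<n)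

  ⊕-right : ∀ t → (f ⊕⟨ n ⟩ g) (n + t) ≡ g t
  ⊕-right t = trans (cong (λ b → if b then f (n + t) else g (n + t ∸ n))
                          (dec-false (n + t <? n) (ℕP.≤⇒≯ (ℕP.m≤m+n n t))))
                    (cong g (ℕP.m+n∸m≡n n t))

  all-⊕ : ∀ {n'} (P : ℤ → Set) → (∀ k → k < n → P (f k)) → (∀ t → t < n' → P (g t)) →
    ∀ k → k < n + n' → P ((f ⊕⟨ n ⟩ g) k)
  all-⊕ {n'} P Pf Pg k k<n+n' with k <? n
  ... | yes k<n = subst P (sym (⊕-left k<n)) (Pf k k<n)
  ... | no  k≮n = subst P (trans (sym (⊕-right t)) (cong (f ⊕⟨ n ⟩ g) n+t≡k)) (Pg t t<n')
    where
    t : ℕ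
    t = k ∸ n
    n+t≡k : n + t ≡ k
    n+t≡k = ℕP.m+[n∸m]≡n (ℕP.≮⇒≥ k≮n)
    t<n' : t < n'
    t<n' = ℕP.+-cancelˡ-< n t n' (subst (_< n + n') (sym n+t≡k) k<n+n')

  Hits-⊕ˡ : ∀ {n' z} → Hits n f z → Hits (n + n') (f ⊕⟨ n ⟩ g) z
  Hits-⊕ˡ {n'} (k , k<n , fk≡z) = k , ℕP.<-≤-trans k<n (ℕP.m≤m+n n n') , trans (⊕-left k<n) fk≡z

  Hits-⊕ʳ : ∀ {n' z} → Hits n' g z → Hits (n + n') (f ⊕⟨ n ⟩ g) z
  Hits-⊕ʳ (t , t<n' , gt≡z) = n + t , ℕP.+-monoʳ-< n t<n' , trans (⊕-right t) gt≡z

  ∑-⊕ : ∀ n' → ∑ (n + n') (f ⊕⟨ n ⟩ g) ≡ ∑ n f ℤ.+ ∑ n' g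
  ∑-⊕ n' = trans (∑-+ n n' (f ⊕⟨ n ⟩ g))
                 (cong₂ ℤ._+_ (∑-cong n (λ k → ⊕-left)) (∑-cong n' (λ t _ → ⊕-right t)))

-- Counting: a map onto a numbered label set is injective.

-- An injective map from Fin n to itself is surjective (otherwise, squeezing out a
-- missed point would inject Fin n into Fin (n - 1)).
injective⇒surjective : ∀ {n} (s : Fin n → Fin n) → Injective _≡_ _≡_ s → ∀ x → ∃ λ y → s y ≡ x
injective⇒surjective {suc n} s s-inj x with FinP.any? (λ y → s y Fin.≟ x)
... | yes hit  = hit
... | no  miss = contradiction (FinP.injective⇒≤ squeeze-injective) ℕP.1+n≰n
  where
  x≢s : ∀ y → x ≢ s y
  x≢s y x≡sy = miss (y , sym x≡sy)
  squeeze : Fin (suc n) → Fin n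
  squeeze y = Fin.punchOut (x≢s y)
  squeeze-injective : Injective _≡_ _≡_ squeeze
  squeeze-injective eq = s-inj (FinP.punchOut-injective (x≢s _) (x≢s _) eq)

rightInverse-onto : ∀ {n} (f s : Fin n → Fin n) → (∀ y → f (s y) ≡ y) → ∀ x → ∃ λ y → s y ≡ x
rightInverse-onto f s f∘s≗id = injective⇒surjective s
  (λ {y} {y'} sy≡sy' → trans (sym (f∘s≗id y)) (trans (cong f sy≡sy') (f∘s≗id y')))

-- A surjective map from Fin n to itself is injective: both arguments lie in the
-- image of a right inverse.
surjective⇒injective : ∀ {n} (f : Fin n → Fin n) → (∀ y → ∃ λ x → f x ≡ y) → Injective _≡_ _≡_ f
surjective⇒injective f f-onto {x} {x'} fx≡fx'
  with y  , refl ← rightInverse-onto f (proj₁ ∘ f-onto) (proj₂ ∘ f-onto) x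
  with y' , refl ← rightInverse-onto f (proj₁ ∘ f-onto) (proj₂ ∘ f-onto) x'
  = cong (proj₁ ∘ f-onto) (trans (sym (proj₂ (f-onto y))) (trans fx≡fx' (proj₂ (f-onto y'))))

record Numbering (n : ℕ) (P : ℤ → Set) : Set where
  field
    code   : ℤ → ℕ
    code<  : ∀ z → P z → code z < n
    decode : ∀ {i} → i < n → ∃ λ z → P z × code z ≡ i

-- Pigeonhole: a map from Fin n into a set numbered by [0, n) that takes every value
-- of the set is injective (composed with the code it is a surjection of Fin n).
numbered⇒injective : ∀ {n P} → Numbering n P → (g : Fin n → ℤ) → (∀ x → P (g x)) →
  (∀ z → P z → ∃ λ x → g x ≡ z) → Injective _≡_ _≡_ g
numbered⇒injective {n} N g g∈P g-onto {x} {y} gx≡gy =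
  surjective⇒injective coded coded-onto (FinP.toℕ-injective (begin
    toℕ (coded x)   ≡⟨ FinP.toℕ-fromℕ< _ ⟩
    code (g x)      ≡⟨ cong code gx≡gy ⟩
    code (g y)      ≡⟨ FinP.toℕ-fromℕ< _ ⟨
    toℕ (coded y)   ∎))
  where
  open Numbering N
  open ≡-Reasoning
  coded : Fin n → Fin n
  coded x = fromℕ< (code< (g x) (g∈P x))
  coded-onto : ∀ i → ∃ λ x → coded x ≡ i
  coded-onto i with z , z∈P , code-z≡i ← decode (FinP.toℕ<n i) with x , gx≡z ← g-onto z z∈P
    = x , FinP.toℕ-injective (trans (FinP.toℕ-fromℕ< _) (trans (cong code gx≡z) code-z≡i))

bijOntoLabels : ∀ {n P} → Numbering n P → (∀ z → InLabels n z ⇔ P z) → (g : ℕ → ℤ) →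
  (∀ k → k < n → P (g k)) → (∀ z → P z → Hits n g z) → BijOntoLabels n (g ∘ toℕ)
bijOntoLabels {n} {P} N labels g g∈P g-onto =
  (λ x → Equivalence.from (labels _) (g∈P _ (FinP.toℕ<n x))) ,
  (λ x y → numbered⇒injective N (g ∘ toℕ) (λ x → g∈P _ (FinP.toℕ<n x)) onto) ,
  (λ z z∈ → onto z (Equivalence.to (labels z) z∈))
  where
  onto : ∀ z → P z → ∃ λ x → g (toℕ x) ≡ z
  onto z z∈P with k , k<n , gk≡z ← g-onto z z∈P
    = fromℕ< k<n , trans (cong g (FinP.toℕ-fromℕ< k<n)) gk≡z

InLabels-of-odd-size : ∀ n z → n ℕ.% 2 ≡ 1 → InLabels n z ≡ (suc (2 * ∣ z ∣) ≤ n)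
InLabels-of-odd-size n z n-odd with n ℕ.% 2 | n-odd
... | .1 | refl = refl

InLabels-of-even-size : ∀ n z → n ℕ.% 2 ≡ 0 → InLabels n z ≡ ((¬ z ≡ 0ℤ) × 2 * ∣ z ∣ ≤ n)
InLabels-of-even-size n z n-even with n ℕ.% 2 | n-even
... | .0 | refl = refl

2m+1%2≡1 : ∀ m → suc (2 * m) ℕ.% 2 ≡ 1
2m+1%2≡1 m = trans (cong (λ x → suc x ℕ.% 2) (ℕP.*-comm 2 m)) (ℕD.[m+kn]%n≡m%n 1 m 2)

2m%2≡0 : ∀ m → 2 * m ℕ.% 2 ≡ 0
2m%2≡0 m = trans (cong (ℕ._% 2) (ℕP.*-comm 2 m)) (ℕD.m*n%n≡0 m 2)

InLabels-odd : ∀ m z → InLabels (suc (2 * m)) z ⇔ ∣ z ∣ ≤ m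
InLabels-odd m z = subst (_⇔ ∣ z ∣ ≤ m) (sym (InLabels-of-odd-size _ z (2m+1%2≡1 m)))
  (mk⇔ (λ le → ℕP.*-cancelˡ-≤ 2 (ℕP.≤-pred le)) (λ le → s≤s (ℕP.*-monoʳ-≤ 2 le)))

InLabels-even : ∀ m z → InLabels (2 * m) z ⇔ (z ≢ 0ℤ × ∣ z ∣ ≤ m)
InLabels-even m z = subst (_⇔ (z ≢ 0ℤ × ∣ z ∣ ≤ m)) (sym (InLabels-of-even-size _ z (2m%2≡0 m)))
  (mk⇔ (λ (z≢0 , le) → z≢0 , ℕP.*-cancelˡ-≤ 2 le) (λ (z≢0 , le) → z≢0 , ℕP.*-monoʳ-≤ 2 le))

halve : ∀ i → ∃ λ k → i ≡ 2 * k ⊎ i ≡ suc (2 * k)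
halve zero = 0 , inj₁ refl
halve (suc i) with halve i
... | k , inj₁ i≡2k   = k , inj₂ (cong suc i≡2k)
... | k , inj₂ i≡1+2k = suc k , inj₁ (trans (cong suc i≡1+2k) (sym (ℕP.*-suc 2 k)))

oddNumbering : ∀ m → Numbering (suc (2 * m)) (λ z → ∣ z ∣ ≤ m)
oddNumbering m = record { code = code ; code< = code< ; decode = decode }
  where
  code : ℤ → ℕ
  code (+ zero)  = 0
  code (+ suc k) = suc (2 * k)
  code -[1+ k ]  = 2 * suc k
  code< : ∀ z → ∣ z ∣ ≤ m → code z < suc (2 * m)
  code< (+ zero)  _  = z<s
  code< (+ suc k) le = s≤s (ℕP.≤-trans (ℕP.*-monoʳ-< 2 (ℕP.n<1+n k)) (ℕP.*-monoʳ-≤ 2 le))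
  code< -[1+ k ] le = s≤s (ℕP.*-monoʳ-≤ 2 le)
  decode : ∀ {i} → i < suc (2 * m) → ∃ λ z → ∣ z ∣ ≤ m × code z ≡ i
  decode {i} i< with halve i
  ... | zero  , inj₁ refl = + 0 , z≤n , refl
  ... | suc k , inj₁ refl = -[1+ k ] , ℕP.*-cancelˡ-≤ 2 (ℕP.≤-pred i<) , refl
  ... | k     , inj₂ refl = + suc k , ℕP.*-cancelˡ-< 2 k m (ℕP.≤-pred i<) , refl

evenNumbering : ∀ m → Numbering (2 * m) (λ z → z ≢ 0ℤ × ∣ z ∣ ≤ m)
evenNumbering m = record { code = code ; code< = code< ; decode = decode }
  where
  code : ℤ → ℕ
  code (+ zero)  = 0    -- 0 is not in the set; any value will do
  code (+ suc k) = 2 * k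
  code -[1+ k ]  = suc (2 * k)
  code< : ∀ z → z ≢ 0ℤ × ∣ z ∣ ≤ m → code z < 2 * m
  code< (+ zero)    (z≢0 , _) = contradiction refl z≢0
  code< (+ suc k)   (_ , le)  = ℕP.*-monoʳ-< 2 le
  code< -[1+ k ]    (_ , le)  = subst (_≤ 2 * m) (ℕP.*-suc 2 k) (ℕP.*-monoʳ-≤ 2 le)
  decode : ∀ {i} → i < 2 * m → ∃ λ z → (z ≢ 0ℤ × ∣ z ∣ ≤ m) × code z ≡ i
  decode {i} i< with halve i
  ... | k , inj₁ refl = + suc k , ((λ ()) , ℕP.*-cancelˡ-< 2 k m i<) , refl
  ... | k , inj₂ refl = -[1+ k ] , ((λ ()) , ℕP.*-cancelˡ-< 2 k m (ℕP.<-trans (ℕP.n<1+n _) i<)) , refl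

bijOntoLabels-odd : ∀ {n} m → n ≡ suc (2 * m) → (g : ℕ → ℤ) → (∀ k → k < n → ∣ g k ∣ ≤ m) →
  (∀ z → ∣ z ∣ ≤ m → Hits n g z) → BijOntoLabels n (g ∘ toℕ)
bijOntoLabels-odd m refl = bijOntoLabels (oddNumbering m) (InLabels-odd m)

bijOntoLabels-even : ∀ {n} m → n ≡ 2 * m → (g : ℕ → ℤ) → (∀ k → k < n → g k ≢ 0ℤ × ∣ g k ∣ ≤ m) →
  (∀ z → z ≢ 0ℤ × ∣ z ∣ ≤ m → Hits n g z) → BijOntoLabels n (g ∘ toℕ)
bijOntoLabels-even m refl = bijOntoLabels (evenNumbering m) (InLabels-even m)

BijOntoLabels-≗ : ∀ {n} {g g' : Fin n → ℤ} → (∀ x → g x ≡ g' x) → BijOntoLabels n g → BijOntoLabels n g'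
BijOntoLabels-≗ {n} g≗g' (in-range , injective , onto) =
  (λ x → subst (InLabels n) (g≗g' x) (in-range x)) ,
  (λ x y eq → injective x y (trans (g≗g' x) (trans eq (sym (g≗g' y))))) ,
  (λ z z∈ → let (x , gx≡z) = onto z z∈ in x , trans (sym (g≗g' x)) gx≡z)

injectiveOn : ∀ {n} g → BijOntoLabels n (g ∘ toℕ) → ∀ {k l} → k < n → l < n → g k ≡ g l → k ≡ l
injectiveOn g (_ , injective , _) {k} {l} k<n l<n gk≡gl = begin
  k                  ≡⟨ FinP.toℕ-fromℕ< k<n ⟨
  toℕ (fromℕ< k<n)   ≡⟨ cong toℕ (injective _ _ (begin
                          g (toℕ (fromℕ< k<n)) ≡⟨ cong g (FinP.toℕ-fromℕ< k<n) ⟩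
                          g k                  ≡⟨ gk≡gl ⟩
                          g l                  ≡⟨ cong g (FinP.toℕ-fromℕ< l<n) ⟨
                          g (toℕ (fromℕ< l<n)) ∎)) ⟩
  toℕ (fromℕ< l<n)   ≡⟨ FinP.toℕ-fromℕ< l<n ⟩
  l                  ∎
  where open ≡-Reasoning

-- Vertex sums of RT(0^j,a,b).

module _ (j a b : ℕ) where

  private
    <ᵇ-true : ∀ {k n} → k < n → (k <ᵇ n) ≡ true
    <ᵇ-true {k} {n} = dec-true (k <? n)

    <ᵇ-false : ∀ {k n} → n ≤ k → (k <ᵇ n) ≡ false
    <ᵇ-false {k} {n} n≤k = dec-false (k <? n) (ℕP.≤⇒≯ n≤k)

    parent-if : Bool → Bool → ℕ
    parent-if root? left? = if root? then 0 else if left? then j + 1 else j + 2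

  parent-root : ∀ {k} → k < j + 2 → RTparent j a b k ≡ 0
  parent-root {k} k< = cong (λ r → parent-if r (k <ᵇ j + 2 + a)) (<ᵇ-true k<)

  parent-left : ∀ {k} → j + 2 ≤ k → k < j + 2 + a → RTparent j a b k ≡ j + 1
  parent-left ≤k k< = cong₂ parent-if (<ᵇ-false ≤k) (<ᵇ-true k<)

  parent-right : ∀ {k} → j + 2 + a ≤ k → RTparent j a b k ≡ j + 2
  parent-right ≤k =
    cong₂ parent-if (<ᵇ-false (ℕP.≤-trans (ℕP.m≤m+n (j + 2) a) ≤k)) (<ᵇ-false ≤k)

  parent≤ : ∀ k → RTparent j a b k ≤ k
  parent≤ k with k <? j + 2 | k <? j + 2 + a
  ... | yes k< | _ = subst (_≤ k) (sym (parent-root k<)) z≤n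
  ... | no  k≮ | yes k<' =
    subst (_≤ k) (sym (parent-left (ℕP.≮⇒≥ k≮) k<')) (ℕP.≤-trans (ℕP.+-monoʳ-≤ j (ℕP.n≤1+n 1)) (ℕP.≮⇒≥ k≮))
  ... | no  _  | no  k≮' =
    subst (_≤ k) (sym (parent-right (ℕP.≮⇒≥ k≮'))) (ℕP.≤-trans (ℕP.m≤m+n (j + 2) a) (ℕP.≮⇒≥ k≮'))

does-≟-toℕ : ∀ {n} (v w : Fin n) → does (v Fin.≟ w) ≡ (toℕ v ≡? toℕ w)
does-≟-toℕ v w with v Fin.≟ w
... | yes refl = sym (dec-true (toℕ v ℕ.≟ toℕ v) refl)
... | no  v≢w  = sym (dec-false (toℕ v ℕ.≟ toℕ w) (v≢w ∘ FinP.toℕ-injective))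

toℕ-clamp : ∀ n k → k ≤ n → toℕ (clamp n k) ≡ k
toℕ-clamp n       zero    _         = refl
toℕ-clamp (suc n) (suc k) (s≤s k≤n) = cong suc (toℕ-clamp n k k≤n)

incident-RT : ∀ j a b v e →
  incident (RT j a b) v e ≡ (toℕ v ≡? RTparent j a b (toℕ e)) ∨ (toℕ v ≡? suc (toℕ e))
incident-RT j a b v e =
  cong₂ _∨_ (trans (does-≟-toℕ v _) (cong (toℕ v ≡?_) (toℕ-clamp _ _ parent≤q))) (does-≟-toℕ v (suc e))
  where
  parent≤q : RTparent j a b (toℕ e) ≤ RTq j a b
  parent≤q = ℕP.≤-trans (parent≤ j a b (toℕ e)) (ℕP.<⇒≤ (FinP.toℕ<n e))

-- The vertex sums of an edge labelling h of RT(0^j,a,b), in closed form: only the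
-- root and its children j + 1 and j + 2 have children.
module VertexSums (j a b : ℕ) (h : ℕ → ℤ) where

  rootSum leftSum rightSum : ℤ
  rootSum  = ∑ (j + 2) h
  leftSum  = ∑ a (λ t → h (j + 2 + t))
  rightSum = ∑ b (λ t → h (j + 2 + a + t))

  childSum : ℕ → ℤ
  childSum v = (when (v ≡? 0) rootSum ℤ.+ when (v ≡? j + 1) leftSum) ℤ.+ when (v ≡? j + 2) rightSum

  vertexLabel : ℕ → ℤ
  vertexLabel v = childSum v ℤ.+ incoming h v

  childSum-blocks : ∀ v → ∑ (RTq j a b) (λ k → when (v ≡? RTparent j a b k) (h k)) ≡ childSum v
  childSum-blocks v = begin
    ∑ (j + 2 + a + b) H
      ≡⟨ ∑-+ (j + 2 + a) b H ⟩
    ∑ (j + 2 + a) H ℤ.+ ∑ b (λ t → H (j + 2 + a + t))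
      ≡⟨ cong (ℤ._+ ∑ b (λ t → H (j + 2 + a + t))) (∑-+ (j + 2) a H) ⟩
    (∑ (j + 2) H ℤ.+ ∑ a (λ t → H (j + 2 + t))) ℤ.+ ∑ b (λ t → H (j + 2 + a + t))
      ≡⟨ cong₂ ℤ._+_ (cong₂ ℤ._+_ root left) right ⟩
    childSum v ∎
    where
    open ≡-Reasoning
    H : ℕ → ℤ
    H k = when (v ≡? RTparent j a b k) (h k)
    guard : ∀ {k c} → RTparent j a b k ≡ c → H k ≡ when (v ≡? c) (h k)
    guard {k} eq = cong (λ c → when (v ≡? c) (h k)) eq
    root : ∑ (j + 2) H ≡ when (v ≡? 0) rootSum
    root = trans (∑-cong (j + 2) (λ k k< → guard (parent-root j a b k<))) (∑-when (j + 2) _ h)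
    left : ∑ a (λ t → H (j + 2 + t)) ≡ when (v ≡? j + 1) leftSum
    left = trans (∑-cong a (λ t t<a → guard (parent-left j a b (ℕP.m≤m+n (j + 2) t) (ℕP.+-monoʳ-< (j + 2) t<a))))
                 (∑-when a _ _)
    right : ∑ b (λ t → H (j + 2 + a + t)) ≡ when (v ≡? j + 2) rightSum
    right = trans (∑-cong b (λ t _ → guard (parent-right j a b (ℕP.m≤m+n (j + 2 + a) t))))
                  (∑-when b _ _)

  vertexSum-RT : ∀ v → vertexSum (RT j a b) (h ∘ toℕ) v ≡ vertexLabel (toℕ v)
  vertexSum-RT v = begin
    vertexSum (RT j a b) (h ∘ toℕ) v
      ≡⟨ sumℤ≡∑ _ _ _ (λ e → cong (λ c → when c (h (toℕ e))) (incident-RT j a b v e)) ⟩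
    ∑ edges (λ k → when ((v' ≡? parent k) ∨ (v' ≡? suc k)) (h k))
      ≡⟨ ∑-cong edges (λ k _ → when-∨ (v' ℕ.≟ parent k) (v' ℕ.≟ suc k) (h k) (parent≢child k)) ⟩
    ∑ edges (λ k → when (v' ≡? parent k) (h k) ℤ.+ when (v' ≡? suc k) (h k))
      ≡⟨ ∑-distrib edges _ _ ⟩
    ∑ edges (λ k → when (v' ≡? parent k) (h k)) ℤ.+ ∑ edges (λ k → when (v' ≡? suc k) (h k))
      ≡⟨ cong₂ ℤ._+_ (childSum-blocks v') (∑-incoming edges h v' (ℕP.≤-pred (FinP.toℕ<n v))) ⟩
    vertexLabel v' ∎
    where
    open ≡-Reasoning
    edges : ℕ
    edges = RTq j a b
    v' : ℕ
    v' = toℕ v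
    parent : ℕ → ℕ
    parent = RTparent j a b
    parent≢child : ∀ k → ¬ (v' ≡ parent k × v' ≡ suc k)
    parent≢child k (v'≡parent , v'≡1+k) =
      ℕP.1+n≰n (subst (_≤ k) (trans (sym v'≡parent) v'≡1+k) (parent≤ j a b k))

  private
    j+1≡1+j : j + 1 ≡ suc j
    j+1≡1+j = ℕP.+-comm j 1
    j+2≡2+j : j + 2 ≡ suc (suc j)
    j+2≡2+j = ℕP.+-comm j 2
    1+j≢2+j : suc j ≢ suc (suc j)
    1+j≢2+j = ℕP.<⇒≢ (ℕP.n<1+n (suc j))

  childSum-root : childSum 0 ≡ rootSum
  childSum-root = begin
    (rootSum ℤ.+ when (0 ≡? j + 1) leftSum) ℤ.+ when (0 ≡? j + 2) rightSum
      ≡⟨ cong₂ ℤ._+_ (cong (ℤ._+_ rootSum) (when-no leftSum (λ eq → ℕP.0≢1+n (trans eq j+1≡1+j))))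
                     (when-no rightSum (λ eq → ℕP.0≢1+n (trans eq j+2≡2+j))) ⟩
    (rootSum ℤ.+ 0ℤ) ℤ.+ 0ℤ
      ≡⟨ trans (ℤP.+-identityʳ _) (ℤP.+-identityʳ _) ⟩
    rootSum ∎
    where open ≡-Reasoning

  childSum-left : childSum (suc j) ≡ leftSum
  childSum-left = begin
    (0ℤ ℤ.+ when (suc j ≡? j + 1) leftSum) ℤ.+ when (suc j ≡? j + 2) rightSum
      ≡⟨ cong₂ ℤ._+_ (cong (ℤ._+_ 0ℤ) (when-yes leftSum (sym j+1≡1+j)))
                     (when-no rightSum (λ eq → 1+j≢2+j (trans eq j+2≡2+j))) ⟩
    (0ℤ ℤ.+ leftSum) ℤ.+ 0ℤ
      ≡⟨ trans (ℤP.+-identityʳ _) (ℤP.+-identityˡ _) ⟩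
    leftSum ∎
    where open ≡-Reasoning

  childSum-right : childSum (suc (suc j)) ≡ rightSum
  childSum-right = begin
    (0ℤ ℤ.+ when (suc (suc j) ≡? j + 1) leftSum) ℤ.+ when (suc (suc j) ≡? j + 2) rightSum
      ≡⟨ cong₂ ℤ._+_ (cong (ℤ._+_ 0ℤ) (when-no leftSum (λ eq → 1+j≢2+j (sym (trans eq j+1≡1+j)))))
                     (when-yes rightSum (sym j+2≡2+j)) ⟩
    0ℤ ℤ.+ rightSum
      ≡⟨ ℤP.+-identityˡ _ ⟩
    rightSum ∎
    where open ≡-Reasoning

  childSum-leaf : ∀ {k} → k ≢ j → k ≢ suc j → childSum (suc k) ≡ 0ℤ
  childSum-leaf k≢j k≢1+j =
    cong₂ ℤ._+_ (cong (ℤ._+_ 0ℤ) (when-no leftSum (λ eq → k≢j (ℕP.suc-injective (trans eq j+1≡1+j)))))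
                (when-no rightSum (λ eq → k≢1+j (ℕP.suc-injective (trans eq j+2≡2+j))))

-- The reduction to edge labellings.

record Admissible (j a b m : ℕ) (h : ℕ → ℤ) : Set where
  open VertexSums j a b h using (rootSum; leftSum; rightSum)
  field
    size       : RTq j a b ≡ suc (2 * m)
    bounded    : ∀ k → k < RTq j a b → ∣ h k ∣ ≤ m
    onto       : ∀ z → ∣ z ∣ ≤ m → Hits (RTq j a b) h z
    left-edge  : h j ≡ 0ℤ
    right-edge : h (suc j) ≡ + m
    root-sum   : rootSum ≡ + suc m
    left-sum   : leftSum ≡ + m
    right-sum  : rightSum ≡ ℤ.- (+ m) ℤ.- (+ suc m)

-- An admissible edge labelling is super edge-graceful: it is a bijection onto the edge
-- labels by counting, and the induced vertex labels are m + 1 at the root, m at j + 1,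
-- -(m + 1) at j + 2 and the label of the incoming edge at every leaf, which are
-- exactly {±1, …, ±(m + 1)}.
admissible⇒superEdgeGraceful : ∀ {j a b m h} → Admissible j a b m h → SuperEdgeGraceful (RT j a b)
admissible⇒superEdgeGraceful {j} {a} {b} {m} {h} adm =
  h ∘ toℕ , edgeBijection , BijOntoLabels-≗ (sym ∘ vertexSum-RT) vertexBijection
  where
  open Admissible adm
  open VertexSums j a b h
  open ≡-Reasoning

  edges : ℕ
  edges = RTq j a b

  edgeBijection : BijOntoLabels edges (h ∘ toℕ)
  edgeBijection = bijOntoLabels-odd m size h bounded onto

  j+2≤edges : j + 2 ≤ edges
  j+2≤edges = ℕP.≤-trans (ℕP.m≤m+n (j + 2) a) (ℕP.m≤m+n (j + 2 + a) b)

  1+j<edges : suc j < edges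
  1+j<edges = ℕP.<-≤-trans (subst (suc j <_) (ℕP.+-comm 2 j) (ℕP.n<1+n (suc j))) j+2≤edges

  j<edges : j < edges
  j<edges = ℕP.<-trans (ℕP.n<1+n j) 1+j<edges

  vertex-root : vertexLabel 0 ≡ + suc m
  vertex-root = trans (ℤP.+-identityʳ _) (trans childSum-root root-sum)

  vertex-left : vertexLabel (suc j) ≡ + m
  vertex-left = begin
    childSum (suc j) ℤ.+ h j  ≡⟨ cong₂ ℤ._+_ (trans childSum-left left-sum) left-edge ⟩
    + m ℤ.+ 0ℤ               ≡⟨ ℤP.+-identityʳ _ ⟩
    + m                      ∎

  cancel-right : ∀ x → (ℤ.- x ℤ.- (+ 1 ℤ.+ x)) ℤ.+ x ≡ ℤ.- (+ 1 ℤ.+ x)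
  cancel-right = ℤSolver.solve-∀

  vertex-right : vertexLabel (suc (suc j)) ≡ -[1+ m ]
  vertex-right = begin
    childSum (suc (suc j)) ℤ.+ h (suc j)          ≡⟨ cong₂ ℤ._+_ (trans childSum-right right-sum) right-edge ⟩
    (ℤ.- (+ m) ℤ.- (+ suc m)) ℤ.+ + m            ≡⟨ cancel-right (+ m) ⟩
    -[1+ m ]                                      ∎

  vertex-leaf : ∀ {k} → k ≢ j → k ≢ suc j → vertexLabel (suc k) ≡ h k
  vertex-leaf k≢j k≢1+j = trans (cong (ℤ._+ _) (childSum-leaf k≢j k≢1+j)) (ℤP.+-identityˡ _)

  -- The edges to j + 1 and j + 2 have different labels, so m ≠ 0.
  m≢0 : + m ≢ 0ℤ
  m≢0 m≡0 = ℕP.1+n≢n (injectiveOn h edgeBijection 1+j<edges j<edges (trans right-edge (trans m≡0 (sym left-edge))))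

  VertexLabel : ℤ → Set
  VertexLabel z = z ≢ 0ℤ × ∣ z ∣ ≤ suc m

  vertexLabel-range : ∀ v → v < suc edges → VertexLabel (vertexLabel v)
  vertexLabel-range zero _ = subst VertexLabel (sym vertex-root) ((λ ()) , ℕP.≤-refl)
  vertexLabel-range (suc k) k<edges with k ℕ.≟ j | k ℕ.≟ suc j
  ... | yes refl | _        = subst VertexLabel (sym vertex-left) (m≢0 , ℕP.n≤1+n m)
  ... | no  _    | yes refl = subst VertexLabel (sym vertex-right) ((λ ()) , ℕP.≤-refl)
  ... | no  k≢j  | no k≢1+j = subst VertexLabel (sym (vertex-leaf k≢j k≢1+j))
                                (hk≢0 , ℕP.m≤n⇒m≤1+n (bounded k (ℕP.≤-pred k<edges)))
    where
    hk≢0 : h k ≢ 0ℤ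
    hk≢0 hk≡0 = k≢j (injectiveOn h edgeBijection (ℕP.≤-pred k<edges) j<edges (trans hk≡0 (sym left-edge)))

  leaf-hits : ∀ z → ∣ z ∣ ≤ m → z ≢ 0ℤ → z ≢ + m → Hits (suc edges) vertexLabel z
  leaf-hits z z≤m z≢0 z≢m with k , k<edges , hk≡z ← onto z z≤m =
    suc k , s<s k<edges , trans (vertex-leaf k≢j k≢1+j) hk≡z
    where
    k≢j : k ≢ j
    k≢j refl = z≢0 (trans (sym hk≡z) left-edge)
    k≢1+j : k ≢ suc j
    k≢1+j refl = z≢m (trans (sym hk≡z) right-edge)

  vertexLabel-onto : ∀ z → VertexLabel z → Hits (suc edges) vertexLabel z
  vertexLabel-onto (+ zero)  (z≢0 , _) = contradiction refl z≢0
  vertexLabel-onto (+ suc t) (_ , t<) with t ℕ.≟ m | suc t ℕ.≟ m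
  ... | yes refl | _      = 0 , z<s , vertex-root
  ... | no  _    | yes eq = suc j , s<s j<edges , trans vertex-left (cong +_ (sym eq))
  ... | no  t≢m  | no 1+t≢m =
    leaf-hits (+ suc t) (ℕP.≤-pred (ℕP.≤∧≢⇒< t< (t≢m ∘ ℕP.suc-injective))) (λ ()) (1+t≢m ∘ ℤP.+-injective)
  vertexLabel-onto -[1+ t ] (_ , t<) with t ℕ.≟ m
  ... | yes refl = suc (suc j) , s<s 1+j<edges , vertex-right
  ... | no  t≢m  = leaf-hits -[1+ t ] (ℕP.≤-pred (ℕP.≤∧≢⇒< t< (t≢m ∘ ℕP.suc-injective))) (λ ()) (λ ())

  vertexBijection : BijOntoLabels (suc edges) (vertexLabel ∘ toℕ)
  vertexBijection = bijOntoLabels-even (suc m) (trans (cong suc size) (sym (ℕP.*-suc 2 m)))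
    vertexLabel vertexLabel-range vertexLabel-onto

-- The construction.

pairs : ℕ → ℕ → ℤ
pairs s zero          = + s
pairs s (suc zero)    = ℤ.- (+ s)
pairs s (suc (suc k)) = pairs (suc s) k

∑-pairs : ∀ n s → ∑ (2 * n) (pairs s) ≡ 0ℤ
∑-pairs zero    s = refl
∑-pairs (suc n) s = begin
  ∑ (2 * suc n) (pairs s)
    ≡⟨ cong (λ l → ∑ l (pairs s)) (ℕP.*-suc 2 n) ⟩
  + s ℤ.+ (ℤ.- (+ s) ℤ.+ ∑ (2 * n) (pairs (suc s)))
    ≡⟨ cong (λ x → + s ℤ.+ (ℤ.- (+ s) ℤ.+ x)) (∑-pairs n (suc s)) ⟩
  + s ℤ.+ (ℤ.- (+ s) ℤ.+ 0ℤ)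
    ≡⟨ cong (ℤ._+_ (+ s)) (ℤP.+-identityʳ (ℤ.- (+ s))) ⟩
  + s ℤ.- (+ s)
    ≡⟨ ℤP.+-inverseʳ (+ s) ⟩
  0ℤ ∎
  where open ≡-Reasoning

pairs-bound : ∀ n s k → k < 2 * n → ∣ pairs s k ∣ < s + n
pairs-bound (suc n) s zero          _  = ℕP.m<m+n s z<s
pairs-bound (suc n) s (suc zero)    _  = subst (_< s + suc n) (sym (ℤP.∣-i∣≡∣i∣ (+ s))) (ℕP.m<m+n s z<s)
pairs-bound (suc n) s (suc (suc k)) k< = subst (∣ pairs (suc s) k ∣ <_) (sym (ℕP.+-suc s n))
  (pairs-bound n (suc s) k (ℕP.≤-pred (ℕP.≤-pred (subst (suc (suc k) <_) (ℕP.*-suc 2 n) k<))))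

pairs-hits : ∀ n s v → s ≤ v → v < s + n → Hits± (2 * n) (pairs s) v
pairs-hits zero    s v s≤v v< = contradiction (subst (v <_) (ℕP.+-identityʳ s) v<) (ℕP.≤⇒≯ s≤v)
pairs-hits (suc n) s v s≤v v< = subst (λ l → Hits± l (pairs s) v) (sym (ℕP.*-suc 2 n)) hits
  where
  hits : Hits± (2 + 2 * n) (pairs s) v
  hits with ℕP.m≤n⇒m<n∨m≡n s≤v
  ... | inj₂ s≡v = subst (Hits± (2 + 2 * n) (pairs s)) s≡v ((0 , z<s , refl) , (1 , s<s z<s , refl))
  ... | inj₁ s<v = Hits±-map (λ hit → Hits-suc (Hits-suc hit))
                     (pairs-hits n (suc s) v s<v (subst (v <_) (ℕP.+-suc s n) v<))

-- The labelling for j = 2J + 1, a = 2A + 3, b = 2B + 3, with m = J + A + B + 4 so that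
-- RT(0^j,a,b) has 2m + 1 edges. Edge labels, block by block:
--   the j leaves of the root : 1, ±3, …, ±(J + 2)
--   the edges to j+1, j+2   : 0, m
--   the a leaves of j + 1   : -1, 2, m - 1, ±(J + 3), …, ±(J + A + 2)       (sum m)
--   the b leaves of j + 2   : -m, -2, -(m - 1), ±(J + A + 3), …, ±(m - 2)  (sum -(2m + 1))
-- Each magnitude 1, …, m occurs once with each sign and 0 occurs once.
module Construction (J A B : ℕ) where

  j a b : ℕ
  j = suc (2 * J)
  a = suc (2 * suc A)
  b = suc (2 * suc B)

  -- The pairs of the three leaf blocks start at magnitudes 3, s₂ and s₃ and end below m' = m - 1.
  s₂ s₃ m' m : ℕ
  s₂ = 3 + J
  s₃ = s₂ + A
  m' = s₃ + B
  m  = suc m'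

  rootBlock spineBlock leftBlock rightBlock : ℕ → ℤ
  rootBlock zero    = + 1
  rootBlock (suc k) = pairs 3 k

  spineBlock zero    = 0ℤ
  spineBlock (suc _) = + m

  leftBlock zero                = -[1+ 0 ]
  leftBlock (suc zero)          = + 2
  leftBlock (suc (suc zero))    = + m'
  leftBlock (suc (suc (suc k))) = pairs s₂ k

  rightBlock zero                = -[1+ m' ]
  rightBlock (suc zero)          = -[1+ 1 ]
  rightBlock (suc (suc zero))    = ℤ.- (+ m')
  rightBlock (suc (suc (suc k))) = pairs s₃ k

  rootAndSpine upToLeft label : ℕ → ℤ
  rootAndSpine = rootBlock ⊕⟨ j ⟩ spineBlock
  upToLeft     = rootAndSpine ⊕⟨ j + 2 ⟩ leftBlock
  label        = upToLeft ⊕⟨ j + 2 + a ⟩ rightBlock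

  edges : ℕ
  edges = RTq j a b

  size : edges ≡ suc (2 * m)
  size = edge-count J A B
    where
    edge-count : ∀ J A B → suc (2 * J) + 2 + suc (2 * suc A) + suc (2 * suc B)
                         ≡ suc (2 * suc (3 + J + A + B))
    edge-count = solve-∀

  a≡3+2A : a ≡ 3 + 2 * A
  a≡3+2A = cong suc (ℕP.*-suc 2 A)

  b≡3+2B : b ≡ 3 + 2 * B
  b≡3+2B = cong suc (ℕP.*-suc 2 B)

  root-total : ∑ j rootBlock ≡ + 1
  root-total = trans (cong (ℤ._+_ (+ 1)) (∑-pairs J 3)) (ℤP.+-identityʳ (+ 1))

  left-total : ∑ a leftBlock ≡ + m
  left-total = begin
    ∑ a leftBlock
      ≡⟨ cong (λ l → ∑ l leftBlock) a≡3+2A ⟩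
    -[1+ 0 ] ℤ.+ (+ 2 ℤ.+ (+ m' ℤ.+ ∑ (2 * A) (pairs s₂)))
      ≡⟨ cong (λ x → -[1+ 0 ] ℤ.+ (+ 2 ℤ.+ (+ m' ℤ.+ x))) (∑-pairs A s₂) ⟩
    -[1+ 0 ] ℤ.+ (+ 2 ℤ.+ (+ m' ℤ.+ 0ℤ))
      ≡⟨ identity (+ m') ⟩
    + m ∎
    where
    open ≡-Reasoning
    identity : ∀ x → ℤ.- (+ 1) ℤ.+ (+ 2 ℤ.+ (x ℤ.+ + 0)) ≡ + 1 ℤ.+ x
    identity = ℤSolver.solve-∀

  right-total : ∑ b rightBlock ≡ ℤ.- (+ m) ℤ.- (+ suc m)
  right-total = begin
    ∑ b rightBlock
      ≡⟨ cong (λ l → ∑ l rightBlock) b≡3+2B ⟩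
    -[1+ m' ] ℤ.+ (-[1+ 1 ] ℤ.+ (ℤ.- (+ m') ℤ.+ ∑ (2 * B) (pairs s₃)))
      ≡⟨ cong (λ x → -[1+ m' ] ℤ.+ (-[1+ 1 ] ℤ.+ (ℤ.- (+ m') ℤ.+ x))) (∑-pairs B s₃) ⟩
    -[1+ m' ] ℤ.+ (-[1+ 1 ] ℤ.+ (ℤ.- (+ m') ℤ.+ 0ℤ))
      ≡⟨ identity (+ m') ⟩
    ℤ.- (+ m) ℤ.- (+ suc m) ∎
    where
    open ≡-Reasoning
    identity : ∀ x → ℤ.- (+ 1 ℤ.+ x) ℤ.+ (ℤ.- (+ 2) ℤ.+ (ℤ.- x ℤ.+ + 0))
                     ≡ ℤ.- (+ 1 ℤ.+ x) ℤ.- (+ 1 ℤ.+ (+ 1 ℤ.+ x))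
    identity = ℤSolver.solve-∀

  label-root : ∀ {k} → k < j + 2 → label k ≡ rootAndSpine k
  label-root k< = trans (⊕-left upToLeft (j + 2 + a) rightBlock (ℕP.<-≤-trans k< (ℕP.m≤m+n (j + 2) a)))
                        (⊕-left rootAndSpine (j + 2) leftBlock k<)

  label-left : ∀ {t} → t < a → label (j + 2 + t) ≡ leftBlock t
  label-left {t} t< = trans (⊕-left upToLeft (j + 2 + a) rightBlock (ℕP.+-monoʳ-< (j + 2) t<))
                            (⊕-right rootAndSpine (j + 2) leftBlock t)

  label-right : ∀ t → label (j + 2 + a + t) ≡ rightBlock t
  label-right = ⊕-right upToLeft (j + 2 + a) rightBlock

  label-spine : ∀ t → t < 2 → label (j + t) ≡ spineBlock t
  label-spine t t<2 = trans (label-root (ℕP.+-monoʳ-< j t<2)) (⊕-right rootBlock j spineBlock t)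

  left-edge : label j ≡ 0ℤ
  left-edge = trans (cong label (sym (ℕP.+-identityʳ j))) (label-spine 0 z<s)

  right-edge : label (suc j) ≡ + m
  right-edge = trans (cong label (ℕP.+-comm 1 j)) (label-spine 1 (s<s z<s))

  root-sum : ∑ (j + 2) label ≡ + suc m
  root-sum = begin
    ∑ (j + 2) label                          ≡⟨ ∑-cong (j + 2) (λ k → label-root) ⟩
    ∑ (j + 2) rootAndSpine                   ≡⟨ ∑-⊕ rootBlock j spineBlock 2 ⟩
    ∑ j rootBlock ℤ.+ (0ℤ ℤ.+ (+ m ℤ.+ 0ℤ))  ≡⟨ cong₂ ℤ._+_ root-total (trans (ℤP.+-identityˡ (+ m ℤ.+ 0ℤ)) (ℤP.+-identityʳ (+ m))) ⟩
    + 1 ℤ.+ + m                             ∎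
    where open ≡-Reasoning

  left-sum : ∑ a (λ t → label (j + 2 + t)) ≡ + m
  left-sum = trans (∑-cong a (λ t → label-left)) left-total

  right-sum : ∑ b (λ t → label (j + 2 + a + t)) ≡ ℤ.- (+ m) ℤ.- (+ suc m)
  right-sum = trans (∑-cong b (λ t _ → label-right t)) right-total

  s₃≤m : s₃ ≤ m
  s₃≤m = ℕP.m≤n⇒m≤1+n (ℕP.m≤m+n s₃ B)

  s₂≤m : s₂ ≤ m
  s₂≤m = ℕP.≤-trans (ℕP.m≤m+n s₂ A) s₃≤m

  m'≤m : m' ≤ m
  m'≤m = ℕP.n≤1+n m'

  pairs-≤m : ∀ {n s k} → s + n ≤ m → k < 2 * n → ∣ pairs s k ∣ ≤ m
  pairs-≤m {n} {s} {k} s+n≤m k< = ℕP.≤-trans (ℕP.<⇒≤ (pairs-bound n s k k<)) s+n≤m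

  tail< : ∀ {k n l} → l ≡ 3 + 2 * n → 3 + k < l → k < 2 * n
  tail< refl k< = ℕP.≤-pred (ℕP.≤-pred (ℕP.≤-pred k<))

  Small : ℤ → Set
  Small z = ∣ z ∣ ≤ m

  rootBlock-small : ∀ k → k < j → Small (rootBlock k)
  rootBlock-small zero    _       = s≤s z≤n
  rootBlock-small (suc k) (s<s k<) = pairs-≤m s₂≤m k<

  spineBlock-small : ∀ k → k < 2 → Small (spineBlock k)
  spineBlock-small zero          _ = z≤n
  spineBlock-small (suc zero)    _ = ℕP.≤-refl
  spineBlock-small (suc (suc _)) (s<s (s<s ()))

  leftBlock-small : ∀ k → k < a → Small (leftBlock k)
  leftBlock-small zero                _  = s≤s z≤n
  leftBlock-small (suc zero)          _  = s≤s (s≤s z≤n)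
  leftBlock-small (suc (suc zero))    _  = m'≤m
  leftBlock-small (suc (suc (suc k))) k< = pairs-≤m {A} s₃≤m (tail< {n = A} a≡3+2A k<)

  rightBlock-small : ∀ k → k < b → Small (rightBlock k)
  rightBlock-small zero                _  = ℕP.≤-refl
  rightBlock-small (suc zero)          _  = s≤s (s≤s z≤n)
  rightBlock-small (suc (suc zero))    _  = subst (_≤ m) (sym (ℤP.∣-i∣≡∣i∣ (+ m'))) m'≤m
  rightBlock-small (suc (suc (suc k))) k< = pairs-≤m {B} m'≤m (tail< {n = B} b≡3+2B k<)

  bounded : ∀ k → k < edges → Small (label k)
  bounded = all-⊕ upToLeft (j + 2 + a) rightBlock Small
              (all-⊕ rootAndSpine (j + 2) leftBlock Small
                 (all-⊕ rootBlock j spineBlock Small rootBlock-small spineBlock-small)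
                 leftBlock-small)
              rightBlock-small

  from-root : ∀ {z} → Hits j rootBlock z → Hits edges label z
  from-root hit = Hits-⊕ˡ upToLeft (j + 2 + a) rightBlock
                    (Hits-⊕ˡ rootAndSpine (j + 2) leftBlock (Hits-⊕ˡ rootBlock j spineBlock hit))

  from-spine : ∀ {z} → Hits 2 spineBlock z → Hits edges label z
  from-spine hit = Hits-⊕ˡ upToLeft (j + 2 + a) rightBlock
                     (Hits-⊕ˡ rootAndSpine (j + 2) leftBlock (Hits-⊕ʳ rootBlock j spineBlock hit))

  from-left : ∀ {z} → Hits a leftBlock z → Hits edges label z
  from-left hit = Hits-⊕ˡ upToLeft (j + 2 + a) rightBlock (Hits-⊕ʳ rootAndSpine (j + 2) leftBlock hit)

  from-right : ∀ {z} → Hits b rightBlock z → Hits edges label z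
  from-right = Hits-⊕ʳ upToLeft (j + 2 + a) rightBlock

  from-tail : ∀ {l n g z} → l ≡ 3 + 2 * n → Hits (2 * n) (λ k → g (3 + k)) z → Hits l g z
  from-tail refl hit = Hits-suc (Hits-suc (Hits-suc hit))

  2<a : 2 < a
  2<a = subst (2 <_) (sym a≡3+2A) (s≤s (s≤s (s≤s z≤n)))

  2<b : 2 < b
  2<b = subst (2 <_) (sym b≡3+2B) (s≤s (s≤s (s≤s z≤n)))

  magnitude : ∀ v → v ≤ m → Hits± edges label v
  magnitude 0 _ = from-spine (0 , z<s , refl) , from-spine (0 , z<s , refl)
  magnitude 1 _ = from-root (0 , z<s , refl) , from-left (0 , z<s , refl)
  magnitude 2 _ = from-left (1 , s<s z<s , refl) , from-right (1 , s<s z<s , refl)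
  magnitude v@(suc (suc (suc _))) v≤m with v <? s₂ | v <? s₃ | v <? m'
  ... | yes v<s₂ | _        | _        =
    Hits±-map (λ hit → from-root (Hits-suc hit)) (pairs-hits J 3 v (s≤s (s≤s (s≤s z≤n))) v<s₂)
  ... | no  v≮s₂ | yes v<s₃ | _        =
    Hits±-map (λ hit → from-left (from-tail {n = A} a≡3+2A hit)) (pairs-hits A s₂ v (ℕP.≮⇒≥ v≮s₂) v<s₃)
  ... | no  _    | no  v≮s₃ | yes v<m' =
    Hits±-map (λ hit → from-right (from-tail {n = B} b≡3+2B hit)) (pairs-hits B s₃ v (ℕP.≮⇒≥ v≮s₃) v<m')
  ... | no  _    | no  _    | no  v≮m' with ℕP.m≤n⇒m<n∨m≡n (ℕP.≮⇒≥ v≮m')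
  ...   | inj₂ m'≡v = subst (Hits± edges label) m'≡v
                        (from-left (2 , 2<a , refl) , from-right (2 , 2<b , refl))
  ...   | inj₁ m'<v = subst (Hits± edges label) (ℕP.≤-antisym m'<v v≤m)
                        (from-spine (1 , s<s z<s , refl) , from-right (0 , z<s , refl))

  onto : ∀ z → ∣ z ∣ ≤ m → Hits edges label z
  onto (+ v)      v≤m = proj₁ (magnitude v v≤m)
  onto -[1+ v ] 1+v≤m = proj₂ (magnitude (suc v) 1+v≤m)

  admissible : Admissible j a b m label
  admissible = record
    { size       = size
    ; bounded    = bounded
    ; onto       = onto
    ; left-edge  = left-edge
    ; right-edge = right-edge
    ; root-sum   = root-sum
    ; left-sum   = left-sum
    ; right-sum  = right-sum
    }

-- RT(0^j,a,b) is super edge-graceful for odd j ≥ 1 and odd a, b ≥ 3 (the hypothesis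
-- a ≤ b only serves to give b ≥ 3).
lemma7 : (j a b : ℕ) → Odd j → Odd a → Odd b → 3 ≤ a → a ≤ b →
    SuperEdgeGraceful (RT j a b)
lemma7 j a b (J , refl) (zero  , refl) _              (s≤s ()) _
lemma7 j a b (J , refl) (suc A , refl) (zero  , refl) _              (s≤s ())
lemma7 j a b (J , refl) (suc A , refl) (suc B , refl) _              _ =
  admissible⇒superEdgeGraceful (Construction.admissible J A B)
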